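{- Let $m$ be even and let $c$ be an integer with $1\le c<m/2$ such that $m/\gcd(m,c)$ is even. Then $G_{\alpha}(m;1,1,c)$ is 3-edge-colorable.
   Context: Let $G$ be the graph with the 11 vertices $A,B,A',B',v,x_1,\dots,x_6$ and the 14 edges $Av,\ vA',\ Ax_6,\ x_6x_2,\ x_6x_5,\ x_2x_4,\ x_2B,\ x_4x_3,\ x_4B',\ x_3A',\ x_3x_5,\ x_5x_1,\ x_1B,\ x_1B'$. For integers $m\ge 3$, $a,b$ with $1\le a,b\le m-1$ and $1\le c<m/2$, $G_{\alpha}(m;a,b,c)$ is the cubic graph with vertex set $\{u_i: u\in V(G),\ i\in\mathbb{Z}_m\}\cup\{w_i: i\in\mathbb{Z}_m\}$ and edges $u_iu'_i$ for every edge $uu'$ of $G$, spoke edges $v_iw_i$, loop edges $w_iw_{i+c}$, and connecting edges $A'_iA_{i+a}$, $B'_iB_{i+b}$ (indices mod $m$). -}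

module Defs where

open import Data.Nat using (ℕ; NonZero; _+_)
open import Data.Nat.DivMod using (_mod_)
open import Data.Fin using (Fin; toℕ)
open import Data.Product using (_×_; _,_; proj₁; proj₂)
open import Data.Sum using (_⊎_)
open import Relation.Binary.PropositionalEquality using (_≡_; _≢_)

record Graph : Set₁ where
  field
    Vertex : Set
    Edge   : Set
    ends   : Edge → Vertex × Vertex

open Graph public

IncidentTo : (G : Graph) → Edge G → Vertex G → Set
IncidentTo G e x = proj₁ (ends G e) ≡ x ⊎ proj₂ (ends G e) ≡ x

Adjacent : (G : Graph) → Edge G → Edge G → Set
Adjacent G e f =
  (IncidentTo G f (proj₁ (ends G e))) ⊎ (IncidentTo G f (proj₂ (ends G e)))

IsProperEdgeColouring : (G : Graph) (k : ℕ) → (Edge G → Fin k) → Set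
IsProperEdgeColouring G k col =
  ∀ e f → e ≢ f → Adjacent G e f → col e ≢ col f

record EdgeColourable (G : Graph) (k : ℕ) : Set where
  constructor colouring
  field
    col    : Edge G → Fin k
    proper : IsProperEdgeColouring G k col

-- The 11 vertices of the base graph G, and the extra vertex w.
data BaseV : Set where
  A B A' B' v x1 x2 x3 x4 x5 x6 w : BaseV

data EdgeLabel : Set where
  eAv evA' eAx6 ex6x2 ex6x5 ex2x4 ex2B ex4x3 ex4B' ex3A' ex3x5 ex5x1 ex1B ex1B' : EdgeLabel
  spoke loop connA connB : EdgeLabel

shift : (m : ℕ) .{{_ : NonZero m}} → Fin m → ℕ → Fin m
shift m i k = (toℕ i + k) mod m

endsα : (m a b c : ℕ) .{{_ : NonZero m}} → EdgeLabel × Fin m → (BaseV × Fin m) × (BaseV × Fin m)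
endsα m a b c (eAv   , i) = (A  , i) , (v  , i)
endsα m a b c (evA'  , i) = (v  , i) , (A' , i)
endsα m a b c (eAx6  , i) = (A  , i) , (x6 , i)
endsα m a b c (ex6x2 , i) = (x6 , i) , (x2 , i)
endsα m a b c (ex6x5 , i) = (x6 , i) , (x5 , i)
endsα m a b c (ex2x4 , i) = (x2 , i) , (x4 , i)
endsα m a b c (ex2B  , i) = (x2 , i) , (B  , i)
endsα m a b c (ex4x3 , i) = (x4 , i) , (x3 , i)
endsα m a b c (ex4B' , i) = (x4 , i) , (B' , i)
endsα m a b c (ex3A' , i) = (x3 , i) , (A' , i)
endsα m a b c (ex3x5 , i) = (x3 , i) , (x5 , i)
endsα m a b c (ex5x1 , i) = (x5 , i) , (x1 , i)
endsα m a b c (ex1B  , i) = (x1 , i) , (B  , i)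
endsα m a b c (ex1B' , i) = (x1 , i) , (B' , i)
endsα m a b c (spoke , i) = (v  , i) , (w  , i)
endsα m a b c (loop  , i) = (w  , i) , (w  , shift m i c)
endsα m a b c (connA , i) = (A' , i) , (A  , shift m i a)
endsα m a b c (connB , i) = (B' , i) , (B  , shift m i b)

Gα : (m a b c : ℕ) .{{_ : NonZero m}} → Graph
Gα m a b c = record
  { Vertex = BaseV × Fin m
  ; Edge   = EdgeLabel × Fin m
  ; ends   = endsα m a b c
  }

-- Colour every copy of G, with its spoke, by one fixed proper 3-edge-colouring in which
-- the spoke gets colour 2, the connector A'_i A_{i+1} colour 2 at both ends, and the
-- connector B'_i B_{i+1} colour 1 at B'_i but 0 at B_{i+1}. Swapping colours 0 and 1 in
-- the odd-indexed copies repairs the B-connectors, as m is even. The loop edges must then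
-- alternate between colours 0 and 1 along the cycles of i ↦ i + c; with g = gcd(m, c),
-- colouring w_i w_{i+c} by the parity of ⌊i/g⌋ does this, because adding c adds the odd
-- number c/g to ⌊i/g⌋ modulo the even number m/g.
module Submission where

open import Defs
open import Data.Nat using (ℕ; NonZero; _≤_; _<_; _*_)
open import Data.Nat.Divisibility using (_∣_; quotient)
open import Data.Nat.GCD using (gcd; gcd[m,n]∣m)

open import Data.Fin using (Fin; toℕ)
open import Data.Fin.Patterns using (0F; 1F; 2F)
open import Data.Fin.Properties using (toℕ-injective; toℕ-fromℕ<; toℕ<n)
open import Data.Nat.Base using (suc; _+_; _∸_; _%_; _/_; parity; ≢-nonZero; ≢-nonZero⁻¹; >-nonZero⁻¹)
open import Data.Nat.Coprimality using (Coprime; coprime-/gcd)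
open import Data.Nat.DivMod
open import Data.Nat.Divisibility using (divides; n∣m*n; m∣n⇒n≡quotient*m; quotient≢0)
open import Data.Nat.GCD using (gcd[m,n]∣n; gcd[m,n]≢0)
open import Data.Nat.Properties
open import Data.Parity.Base as ℙ using (Parity; 0ℙ; 1ℙ; _⁻¹)
import Data.Parity.Properties as Parityₚ
open import Data.Product using (_×_; _,_; proj₁; proj₂)
open import Data.Sum using (inj₁; inj₂)
open import Data.Vec using (Vec; []; _∷_; lookup)
open import Function using (_∘_)
open import Relation.Binary.PropositionalEquality

-- A colouring is proper once each edge is determined by its colour and either endpoint.

Recovers : (G : Graph) {k : ℕ} → (Edge G → Fin k) → (Vertex G → Fin k → Edge G) → Set
Recovers G col edgeAt =
  ∀ e → edgeAt (proj₁ (ends G e)) (col e) ≡ e × edgeAt (proj₂ (ends G e)) (col e) ≡ e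

module _ (G : Graph) {k : ℕ} (col : Edge G → Fin k) (edgeAt : Vertex G → Fin k → Edge G)
         (recovers : Recovers G col edgeAt) where

  recovers-incident : ∀ {e x} → IncidentTo G e x → edgeAt x (col e) ≡ e
  recovers-incident {e} (inj₁ refl) = proj₁ (recovers e)
  recovers-incident {e} (inj₂ refl) = proj₂ (recovers e)

  same-colour-at : ∀ {e f x} → edgeAt x (col e) ≡ e → IncidentTo G f x → col e ≡ col f → e ≡ f
  same-colour-at {x = x} e-at-x f∋x ce≡cf =
    trans (sym e-at-x) (trans (cong (edgeAt x) ce≡cf) (recovers-incident f∋x))

  recovers⇒proper : IsProperEdgeColouring G k col
  recovers⇒proper e f e≢f (inj₁ f∋x) = e≢f ∘ same-colour-at (proj₁ (recovers e)) f∋x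
  recovers⇒proper e f e≢f (inj₂ f∋y) = e≢f ∘ same-colour-at (proj₂ (recovers e)) f∋y

parity-even : ∀ {n} → 2 ∣ n → parity n ≡ 0ℙ
parity-even (divides q refl) = trans (Parityₚ.*-homo-* q 2) (Parityₚ.*-zeroʳ (parity q))

parity≡0ℙ⇒even : ∀ n → parity n ≡ 0ℙ → 2 ∣ n
parity≡0ℙ⇒even 0 _ = divides 0 refl
parity≡0ℙ⇒even (suc (suc n)) p with divides q eq ← parity≡0ℙ⇒even n p =
  divides (suc q) (cong (2 +_) eq)

coprime-to-even⇒odd : ∀ {a b} → Coprime a b → 2 ∣ a → parity b ≡ 1ℙ
coprime-to-even⇒odd {b = b} coprime 2∣a with parity b in eq
... | 1ℙ = refl
... | 0ℙ with () ← coprime (2∣a , parity≡0ℙ⇒even b eq)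

parity-%-even : ∀ x d .{{_ : NonZero d}} → 2 ∣ d → parity (x % d) ≡ parity x
parity-%-even x d 2∣d = begin
  parity (x % d)                                    ≡⟨ Parityₚ.+-identityʳ _ ⟨
  parity (x % d) ℙ.+ 0ℙ                             ≡⟨ cong (parity (x % d) ℙ.+_) d-even ⟨
  parity (x % d) ℙ.+ (parity (x / d) ℙ.* parity d) ≡⟨ cong (parity (x % d) ℙ.+_) (Parityₚ.*-homo-* (x / d) d) ⟨
  parity (x % d) ℙ.+ parity (x / d * d)             ≡⟨ Parityₚ.+-homo-+ (x % d) (x / d * d) ⟨
  parity (x % d + x / d * d)                        ≡⟨ cong parity (m≡m%n+[m/n]*n x d) ⟨
  parity x                                          ∎
  where
  open ≡-Reasoning
  d-even : parity (x / d) ℙ.* parity d ≡ 0ℙ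
  d-even = trans (cong (parity (x / d) ℙ.*_) (parity-even 2∣d)) (Parityₚ.*-zeroʳ _)

parity-[t+Kd]%[Md]/d : ∀ t M K d .{{_ : NonZero M}} .{{_ : NonZero d}} .{{_ : NonZero (M * d)}} →
  2 ∣ M → parity K ≡ 1ℙ → parity ((t + K * d) % (M * d) / d) ≡ parity (t / d) ⁻¹
parity-[t+Kd]%[Md]/d t M K d 2∣M K-odd = begin
  parity ((t + K * d) % (M * d) / d)  ≡⟨ cong parity (m%[n*o]/o≡m/o%n (t + K * d) M d {{_}} {{_}} {{m*n≢0 M d}}) ⟩
  parity ((t + K * d) / d % M)        ≡⟨ parity-%-even ((t + K * d) / d) M 2∣M ⟩
  parity ((t + K * d) / d)            ≡⟨ cong parity (+-distrib-/-∣ʳ t (n∣m*n K)) ⟩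
  parity (t / d + K * d / d)          ≡⟨ cong (λ q → parity (t / d + q)) (m*n/n≡m K d) ⟩
  parity (t / d + K)                  ≡⟨ Parityₚ.+-homo-+ (t / d) K ⟩
  parity (t / d) ℙ.+ parity K         ≡⟨ cong (parity (t / d) ℙ.+_) K-odd ⟩
  parity (t / d) ℙ.+ 1ℙ               ≡⟨ Parityₚ.+-comm (parity (t / d)) 1ℙ ⟩
  parity (t / d) ⁻¹                   ∎
  where open ≡-Reasoning

quotient≡/ : ∀ {d n} .{{_ : NonZero d}} (d∣n : d ∣ n) → quotient d∣n ≡ n / d
quotient≡/ {d} (divides q refl) = sym (m*n/n≡m q d)

module _ (m : ℕ) .{{_ : NonZero m}} where

  toℕ-shift : ∀ (i : Fin m) k → toℕ (shift m i k) ≡ (toℕ i + k) % m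
  toℕ-shift i k = toℕ-fromℕ< (m%n<n (toℕ i + k) m)

  unshift : Fin m → ℕ → Fin m
  unshift j k = shift m j (m ∸ k)

  unshift-shift : ∀ {k} → k ≤ m → (i : Fin m) → unshift (shift m i k) k ≡ i
  unshift-shift {k} k≤m i = toℕ-injective (begin
    toℕ (shift m (shift m i k) (m ∸ k))  ≡⟨ toℕ-shift (shift m i k) (m ∸ k) ⟩
    (toℕ (shift m i k) + (m ∸ k)) % m    ≡⟨ cong (λ x → (x + (m ∸ k)) % m) (toℕ-shift i k) ⟩
    ((toℕ i + k) % m + (m ∸ k)) % m      ≡⟨ %-distribˡ-+ ((toℕ i + k) % m) (m ∸ k) m ⟩
    ((toℕ i + k) % m % m + (m ∸ k) % m) % m
                                         ≡⟨ cong (λ x → (x + (m ∸ k) % m) % m) (m%n%n≡m%n (toℕ i + k) m) ⟩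
    ((toℕ i + k) % m + (m ∸ k) % m) % m  ≡⟨ %-distribˡ-+ (toℕ i + k) (m ∸ k) m ⟨
    (toℕ i + k + (m ∸ k)) % m            ≡⟨ cong (_% m) (+-assoc (toℕ i) k (m ∸ k)) ⟩
    (toℕ i + (k + (m ∸ k))) % m          ≡⟨ cong (λ x → (toℕ i + x) % m) (m+[n∸m]≡n k≤m) ⟩
    (toℕ i + m) % m                      ≡⟨ [m+n]%n≡m%n (toℕ i) m ⟩
    toℕ i % m                            ≡⟨ m<n⇒m%n≡m (toℕ<n i) ⟩
    toℕ i                                ∎)
    where open ≡-Reasoning

  blockParity : (d : ℕ) .{{_ : NonZero d}} → Fin m → Parity
  blockParity d i = parity (toℕ i / d)

blockParity-shift : ∀ m M K d k .{{_ : NonZero m}} .{{_ : NonZero M}} .{{_ : NonZero d}} →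
  m ≡ M * d → k ≡ K * d → 2 ∣ M → parity K ≡ 1ℙ →
  (i : Fin m) → blockParity m d (shift m i k) ≡ blockParity m d i ⁻¹
blockParity-shift .(M * d) M K d .(K * d) refl refl 2∣M K-odd i = begin
  parity (toℕ (shift (M * d) i (K * d)) / d)  ≡⟨ cong (λ x → parity (x / d)) (toℕ-shift (M * d) i (K * d)) ⟩
  parity ((toℕ i + K * d) % (M * d) / d)      ≡⟨ parity-[t+Kd]%[Md]/d (toℕ i) M K d 2∣M K-odd ⟩
  parity (toℕ i / d) ⁻¹                       ∎
  where open ≡-Reasoning

swap : Parity → Fin 3 → Fin 3
swap 0ℙ k  = k
swap 1ℙ 0F = 1F
swap 1ℙ 1F = 0F
swap 1ℙ 2F = 2F

swap-+ : ∀ p q k → swap p (swap q k) ≡ swap (p ℙ.+ q) k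
swap-+ 0ℙ q  k  = refl
swap-+ 1ℙ 0ℙ k  = refl
swap-+ 1ℙ 1ℙ 0F = refl
swap-+ 1ℙ 1ℙ 1F = refl
swap-+ 1ℙ 1ℙ 2F = refl

swap-involutive : ∀ p k → swap p (swap p k) ≡ k
swap-involutive p k = trans (swap-+ p p k) (cong (λ q → swap q k) (Parityₚ.p+p≡0ℙ p))

swap-⁻¹ : ∀ p k → swap (p ⁻¹) (swap p k) ≡ swap 1ℙ k
swap-⁻¹ p k = trans (swap-+ (p ⁻¹) p k) (cong (λ q → swap q k) (Parityₚ.p⁻¹+p≡1ℙ p))

swap-2F : ∀ p → swap p 2F ≡ 2F
swap-2F 0ℙ = refl
swap-2F 1ℙ = refl

-- Colours in an even-indexed copy; a connector's colour is the one at its primed end.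
baseColour : EdgeLabel → Fin 3
baseColour eAv   = 0F
baseColour evA'  = 1F
baseColour eAx6  = 1F
baseColour ex6x2 = 0F
baseColour ex6x5 = 2F
baseColour ex2x4 = 1F
baseColour ex2B  = 2F
baseColour ex4x3 = 2F
baseColour ex4B' = 0F
baseColour ex3A' = 0F
baseColour ex3x5 = 1F
baseColour ex5x1 = 0F
baseColour ex1B  = 1F
baseColour ex1B' = 2F
baseColour spoke = 2F
baseColour loop  = 0F
baseColour connA = 2F
baseColour connB = 1F

module Colouring (m c d M C : ℕ) .{{_ : NonZero m}} .{{_ : NonZero M}} .{{_ : NonZero d}}
                 (2∣m : 2 ∣ m) (c≤m : c ≤ m) (m≡Md : m ≡ M * d) (c≡Cd : c ≡ C * d)
                 (2∣M : 2 ∣ M) (C-odd : parity C ≡ 1ℙ) where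

  copyLevel loopLevel : Fin m → Parity
  copyLevel = blockParity m 1
  loopLevel = blockParity m d

  1≤m : 1 ≤ m
  1≤m = >-nonZero⁻¹ m

  copyLevel-shift : ∀ i → copyLevel (shift m i 1) ≡ copyLevel i ⁻¹
  copyLevel-shift = blockParity-shift m m 1 1 1 (sym (*-identityʳ m)) refl 2∣m refl

  loopLevel-shift : ∀ i → loopLevel (shift m i c) ≡ loopLevel i ⁻¹
  loopLevel-shift = blockParity-shift m M C d c m≡Md c≡Cd 2∣M C-odd

  edgeLevel : EdgeLabel → Fin m → Parity
  edgeLevel loop = loopLevel
  edgeLevel _    = copyLevel

  vertexLevel : BaseV → Fin m → Parity
  vertexLevel w = loopLevel
  vertexLevel _ = copyLevel

  col : EdgeLabel × Fin m → Fin 3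
  col (l , i) = swap (edgeLevel l i) (baseColour l)

  -- The k-th entry of row u j is the edge at u_j of base colour k.
  row : BaseV → Fin m → Vec (EdgeLabel × Fin m) 3
  row A  j = (eAv   , j) ∷ (eAx6  , j) ∷ (connA , unshift m j 1) ∷ []
  row B  j = (connB , unshift m j 1) ∷ (ex1B , j) ∷ (ex2B , j) ∷ []
  row A' j = (ex3A' , j) ∷ (evA'  , j) ∷ (connA , j) ∷ []
  row B' j = (ex4B' , j) ∷ (connB , j) ∷ (ex1B' , j) ∷ []
  row v  j = (eAv   , j) ∷ (evA'  , j) ∷ (spoke , j) ∷ []
  row x1 j = (ex5x1 , j) ∷ (ex1B  , j) ∷ (ex1B' , j) ∷ []
  row x2 j = (ex6x2 , j) ∷ (ex2x4 , j) ∷ (ex2B  , j) ∷ []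
  row x3 j = (ex3A' , j) ∷ (ex3x5 , j) ∷ (ex4x3 , j) ∷ []
  row x4 j = (ex4B' , j) ∷ (ex2x4 , j) ∷ (ex4x3 , j) ∷ []
  row x5 j = (ex5x1 , j) ∷ (ex3x5 , j) ∷ (ex6x5 , j) ∷ []
  row x6 j = (ex6x2 , j) ∷ (eAx6  , j) ∷ (ex6x5 , j) ∷ []
  row w  j = (loop  , j) ∷ (loop  , unshift m j c) ∷ (spoke , j) ∷ []

  edgeAt : BaseV × Fin m → Fin 3 → EdgeLabel × Fin m
  edgeAt (u , j) k = lookup (row u j) (swap (vertexLevel u j) k)

  recovers : Recovers (Gα m 1 1 c) col edgeAt
  recovers (eAv   , i) rewrite swap-involutive (copyLevel i) 0F = refl , refl
  recovers (evA'  , i) rewrite swap-involutive (copyLevel i) 1F = refl , refl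
  recovers (eAx6  , i) rewrite swap-involutive (copyLevel i) 1F = refl , refl
  recovers (ex6x2 , i) rewrite swap-involutive (copyLevel i) 0F = refl , refl
  recovers (ex6x5 , i) rewrite swap-involutive (copyLevel i) 2F = refl , refl
  recovers (ex2x4 , i) rewrite swap-involutive (copyLevel i) 1F = refl , refl
  recovers (ex2B  , i) rewrite swap-involutive (copyLevel i) 2F = refl , refl
  recovers (ex4x3 , i) rewrite swap-involutive (copyLevel i) 2F = refl , refl
  recovers (ex4B' , i) rewrite swap-involutive (copyLevel i) 0F = refl , refl
  recovers (ex3A' , i) rewrite swap-involutive (copyLevel i) 0F = refl , refl
  recovers (ex3x5 , i) rewrite swap-involutive (copyLevel i) 1F = refl , refl
  recovers (ex5x1 , i) rewrite swap-involutive (copyLevel i) 0F = refl , refl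
  recovers (ex1B  , i) rewrite swap-involutive (copyLevel i) 1F = refl , refl
  recovers (ex1B' , i) rewrite swap-involutive (copyLevel i) 2F = refl , refl
  recovers (spoke , i)
    rewrite swap-involutive (copyLevel i) 2F | swap-2F (copyLevel i) | swap-2F (loopLevel i)
    = refl , refl
  recovers (loop , i)
    rewrite swap-involutive (loopLevel i) 0F | loopLevel-shift i | swap-⁻¹ (loopLevel i) 0F
    = refl , cong (loop ,_) (unshift-shift m c≤m i)
  recovers (connA , i)
    rewrite swap-involutive (copyLevel i) 2F | copyLevel-shift i | swap-⁻¹ (copyLevel i) 2F
    = refl , cong (connA ,_) (unshift-shift m 1≤m i)
  recovers (connB , i)
    rewrite swap-involutive (copyLevel i) 1F | copyLevel-shift i | swap-⁻¹ (copyLevel i) 1F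
    = refl , cong (connB ,_) (unshift-shift m 1≤m i)

theorem6 : (m c : ℕ) .{{_ : NonZero m}} → 3 ≤ m → 2 ∣ m → 1 ≤ c → 2 * c < m
    → 2 ∣ quotient (gcd[m,n]∣m m c)
    → EdgeColourable (Gα m 1 1 c) 3
theorem6 m c _ 2∣m _ 2c<m 2∣M = colouring col (recovers⇒proper (Gα m 1 1 c) col edgeAt recovers)
  where
  g : ℕ
  g = gcd m c

  g∣m : g ∣ m
  g∣m = gcd[m,n]∣m m c

  g∣c : g ∣ c
  g∣c = gcd[m,n]∣n m c

  instance
    g≢0 : NonZero g
    g≢0 = ≢-nonZero (gcd[m,n]≢0 m c (inj₁ (≢-nonZero⁻¹ m)))

  c≤m : c ≤ m
  c≤m = ≤-trans (m≤m+n c (c + 0)) (<⇒≤ 2c<m)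

  C-odd : parity (quotient g∣c) ≡ 1ℙ
  C-odd = begin
    parity (quotient g∣c)  ≡⟨ cong parity (quotient≡/ g∣c) ⟩
    parity (c / g)         ≡⟨ coprime-to-even⇒odd (coprime-/gcd m c) (subst (2 ∣_) (quotient≡/ g∣m) 2∣M) ⟩
    1ℙ                     ∎
    where open ≡-Reasoning

  open Colouring m c g (quotient g∣m) (quotient g∣c) {{_}} {{quotient≢0 g∣m}}
    2∣m c≤m (m∣n⇒n≡quotient*m g∣m) (m∣n⇒n≡quotient*m g∣c) 2∣M C-odd
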